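{- Let $G_1$ be the graph obtained from a triangle $v_1v_2v_3$ by attaching one pendent vertex $u_i$ to each $v_i$ ($i=1,2,3$), and let $D$ be an orientation of $G_1$. Then $M_1(D)\leq 13$, with equality if and only if two of the three triangle vertices $v_1,v_2,v_3$ are each a source or a sink in $D$ (there are exactly $12$ such orientations).
   Context: For a digraph $D=(V,A)$ with out-degrees $d^{+}$ and in-degrees $d^{ - }$, $M_1(D)=\frac{1}{2}\sum_{uv\in A}(d^{+}_u+d^{ - }_v)$, where $uv$ is an arc from $u$ to $v$. An orientation of a graph replaces each edge $uv$ by exactly one of the arcs $uv$, $vu$. A vertex is a source if its in-degree is $0$ and a sink if its out-degree is $0$. -}

module Defs where

open import Data.Nat as ℕ using (ℕ; suc; zero; _+_)
open import Data.Nat.Properties as ℕP using ()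
open import Data.Integer using (+_)
open import Data.Rational using (ℚ; _/_)
open import Data.Fin using (Fin)
open import Data.Fin.Properties using () renaming (_≟_ to _≟ᶠ_)
open import Data.Bool using (Bool; true; false)
open import Data.Vec using (Vec; []; _∷_; lookup)
open import Data.Nat.ListAction using (sum)
open import Data.List using (List; []; _∷_; map; length; filter; zip; _++_)
open import Data.Product using (_×_; _,_; ∃-syntax)
open import Data.Sum using (_⊎_)
open import Relation.Binary.PropositionalEquality using (_≡_; _≢_)
open import Relation.Nullary using (Dec; yes; no; ¬_)
open import Relation.Nullary.Decidable using (⌊_⌋)

-- A digraph on vertex set Fin n is given by its list of arcs (u , v), meaning u → v.
Arc : ℕ → Set
Arc n = Fin n × Fin n

count : ∀ {n} → (Arc n → Bool) → List (Arc n) → ℕ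
count p [] = 0
count p (a ∷ as) with p a
... | true  = suc (count p as)
... | false = count p as

outdeg : ∀ {n} → List (Arc n) → Fin n → ℕ
outdeg A w = count (λ { (u , _) → ⌊ u ≟ᶠ w ⌋ }) A

indeg : ∀ {n} → List (Arc n) → Fin n → ℕ
indeg A w = count (λ { (_ , v) → ⌊ v ≟ᶠ w ⌋ }) A

M₁ : ∀ {n} → List (Arc n) → ℚ
M₁ A = (+ sum (map (λ { (u , v) → outdeg A u + indeg A v }) A)) / 2

isSource : ∀ {n} → List (Arc n) → Fin n → Set
isSource A w = indeg A w ≡ 0

isSink : ∀ {n} → List (Arc n) → Fin n → Set
isSink A w = outdeg A w ≡ 0

-- An orientation of a graph with edge list E: one Bool per edge;
-- true keeps the edge (u , v) as the arc u → v, false reverses it to v → u.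
Orientation : ∀ {n} → List (Arc n) → Set
Orientation E = Vec Bool (length E)

orient : ∀ {n} (E : List (Arc n)) → Orientation E → List (Arc n)
orient [] [] = []
orient ((u , v) ∷ E) (true  ∷ bs) = (u , v) ∷ orient E bs
orient ((u , v) ∷ E) (false ∷ bs) = (v , u) ∷ orient E bs

allVecs : (k : ℕ) → List (Vec Bool k)
allVecs zero = [] ∷ []
allVecs (suc k) = map (true ∷_) (allVecs k) ++ map (false ∷_) (allVecs k)

v₁ v₂ v₃ u₁ u₂ u₃ : Fin 6
v₁ = Fin.zero
v₂ = Fin.suc Fin.zero
v₃ = Fin.suc (Fin.suc Fin.zero)
u₁ = Fin.suc (Fin.suc (Fin.suc Fin.zero))
u₂ = Fin.suc (Fin.suc (Fin.suc (Fin.suc Fin.zero)))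
u₃ = Fin.suc (Fin.suc (Fin.suc (Fin.suc (Fin.suc Fin.zero))))

G₁ : List (Arc 6)
G₁ = (v₁ , v₂) ∷ (v₂ , v₃) ∷ (v₁ , v₃) ∷ (v₁ , u₁) ∷ (v₂ , u₂) ∷ (v₃ , u₃) ∷ []

tri : Fin 3 → Fin 6
tri Fin.zero = v₁
tri (Fin.suc Fin.zero) = v₂
tri (Fin.suc (Fin.suc Fin.zero)) = v₃

SourceOrSink : ∀ {n} → List (Arc n) → Fin n → Set
SourceOrSink A w = isSource A w ⊎ isSink A w

TwoTriSourceSink : List (Arc 6) → Set
TwoTriSourceSink A = ∃[ i ] ∃[ j ] (i ≢ j × SourceOrSink A (tri i) × SourceOrSink A (tri j))

sos? : List (Arc 6) → Fin 6 → Bool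
sos? A w with indeg A w ℕ.≟ 0 | outdeg A w ℕ.≟ 0
... | no _ | no _ = false
... | _    | _    = true

twoTri? : List (Arc 6) → Bool
twoTri? A with sos? A v₁ | sos? A v₂ | sos? A v₃
... | true  | true  | _    = true
... | true  | false | true = true
... | false | true  | true = true
... | _     | _     | _    = false

countOrientations : (Orientation G₁ → Bool) → ℕ
countOrientations p = length (filter (λ o → Data.Bool._≟_ (p o) true) (allVecs 6))
  where import Data.Bool

13ℚ : ℚ
13ℚ = (+ 13) / 1

-- G₁ has six edges, hence only 2⁶ = 64 orientations; the bound, the
-- characterisation of equality and the count are all decidable, so they are
-- verified by running the decision procedures over every orientation.
module Submission where

open import Defs
open import Data.Bool using (Bool; true; false)
open import Data.Fin.Properties using (any?) renaming (_≟_ to _≟ᶠ_)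
open import Data.List using (List; map; _++_)
open import Data.List.Membership.Propositional using (_∈_)
open import Data.List.Membership.Propositional.Properties using (∈-map⁺; ∈-++⁺ˡ; ∈-++⁺ʳ)
open import Data.List.Relation.Unary.All as All using (All; all?)
open import Data.List.Relation.Unary.Any using (here)
open import Data.Nat using () renaming (_≟_ to _≟ℕ_)
open import Data.Product using (_×_; _,_; uncurry)
open import Data.Rational using (_≤_; _≤?_) renaming (_≟_ to _≟ℚ_)
open import Data.Vec using (Vec; []; _∷_)
open import Function.Bundles using (_⇔_; mk⇔; Equivalence)
open import Relation.Binary.PropositionalEquality using (_≡_; refl)
open import Relation.Nullary using (Dec; ¬?)
open import Relation.Nullary.Decidable using (_×-dec_; _⊎-dec_; _→-dec_; map′; from-yes)
open import Relation.Unary using (Pred; Decidable)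

_⇔-dec_ : ∀ {a b} {A : Set a} {B : Set b} → Dec A → Dec B → Dec (A ⇔ B)
a? ⇔-dec b? = map′ (uncurry mk⇔) (λ e → Equivalence.to e , Equivalence.from e)
                   ((a? →-dec b?) ×-dec (b? →-dec a?))

∈-allVecs : ∀ {k} (v : Vec Bool k) → v ∈ allVecs k
∈-allVecs []          = here refl
∈-allVecs (true ∷ v)  = ∈-++⁺ˡ (∈-map⁺ (true ∷_) (∈-allVecs v))
∈-allVecs (false ∷ v) = ∈-++⁺ʳ (map (true ∷_) (allVecs _)) (∈-map⁺ (false ∷_) (∈-allVecs v))

all-allVecs⇒∀ : ∀ {k p} {P : Pred (Vec Bool k) p} → All P (allVecs k) → ∀ v → P v
all-allVecs⇒∀ pvs v = All.lookup pvs (∈-allVecs v)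

sourceOrSink? : ∀ {n} (A : List (Arc n)) → Decidable (SourceOrSink A)
sourceOrSink? A w = (indeg A w ≟ℕ 0) ⊎-dec (outdeg A w ≟ℕ 0)

twoTriSourceSink? : (A : List (Arc 6)) → Dec (TwoTriSourceSink A)
twoTriSourceSink? A = any? λ i → any? λ j →
  ¬? (i ≟ᶠ j) ×-dec sourceOrSink? A (tri i) ×-dec sourceOrSink? A (tri j)

M₁-BoundWithEquality : List (Arc 6) → Set
M₁-BoundWithEquality A = (M₁ A ≤ 13ℚ) × ((M₁ A ≡ 13ℚ) ⇔ TwoTriSourceSink A)

M₁-boundWithEquality? : Decidable M₁-BoundWithEquality
M₁-boundWithEquality? A =
  (M₁ A ≤? 13ℚ) ×-dec ((M₁ A ≟ℚ 13ℚ) ⇔-dec twoTriSourceSink? A)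

lemma10 : ((D : Orientation G₁) →
    (M₁ (orient G₁ D) ≤ 13ℚ) ×
    ((M₁ (orient G₁ D) ≡ 13ℚ) ⇔ TwoTriSourceSink (orient G₁ D)))
    × (countOrientations (λ D → twoTri? (orient G₁ D)) ≡ 12)
lemma10 = all-allVecs⇒∀ (from-yes (all? (λ D → M₁-boundWithEquality? (orient G₁ D)) (allVecs 6)))
        , refl
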